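{- Let $n$ be a $2$-near perfect number with omitted divisors $d_1$ and $d_2$, and assume $n = 2^k p^2$ where $p$ is prime and $k$ is a nonnegative integer. Then $n \in \{18, 36, 200\}$.
   Context: $\sigma(n)$ denotes the sum of the positive divisors of $n$. A positive integer $n$ is called $2$-near perfect if $\sigma(n) = 2n + d_1 + d_2$ for some two distinct positive divisors $d_1, d_2$ of $n$; these $d_1, d_2$ are called the omitted divisors. -}

module Defs where

open import Data.Nat using (ℕ; suc; _+_; _*_; _<_)
open import Data.Nat.Divisibility using (_∣_; _∣?_)
open import Data.List using (List; filter; map; upTo)
open import Data.Nat.ListAction using (sum)
open import Data.Product using (∃₂; _×_)
open import Relation.Binary.PropositionalEquality using (_≡_; _≢_)

divisors : ℕ → List ℕ
divisors n = filter (_∣? n) (map suc (upTo n))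

σ : ℕ → ℕ
σ n = sum (divisors n)

IsOmittedPair : ℕ → ℕ → ℕ → Set
IsOmittedPair n d₁ d₂ =
  d₁ ∣ n × d₂ ∣ n × 0 < d₁ × 0 < d₂ × d₁ ≢ d₂ × σ n ≡ 2 * n + d₁ + d₂

TwoNearPerfect : ℕ → Set
TwoNearPerfect n = 0 < n × ∃₂ λ d₁ d₂ → IsOmittedPair n d₁ d₂

{-# OPTIONS --safe #-}
-- For an odd prime p and n = 2^k p², σ(n) = (2^(k+1) − 1)(1 + p + p²), so the omitted divisors
-- satisfy d₁ + d₂ + 1 + p + p² = 2^(k+1)(1 + p). The right side is even and 1 + p + p² is odd,
-- so one omitted divisor is an odd divisor o of p² and the other is s q with s = 2^a, 1 ≤ a ≤ k,
-- q ∣ p². Writing 2^k = s r, the equation becomes s D = o + 1 + p + p² with D = 2r(1 + p) − q,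
-- and D ≡ −1 or +1 modulo 1 + p according as q ∈ {1, p²} or q = p. Reducing modulo 1 + p
-- expresses s through a multiple of 1 + p, after which the remaining polynomial equations have
-- only the solutions giving n = 18, 36 and 200. For p = 2, n is a power of two and
-- σ(n) = 2n − 1 is too small.
module Submission where

open import Defs
open import Data.Nat
  using (ℕ; zero; suc; _+_; _*_; _^_; _<_; _≤_; s≤s; z≤n; NonZero; ≢-nonZero⁻¹; nonTrivial⇒n>1; parity)
open import Data.Nat.Properties
open import Data.Nat.Divisibility
open import Data.Nat.Primality
  using (Prime; prime[2]; prime⇒irreducible; prime⇒nonZero; prime⇒nonTrivial; ¬prime[1])
open import Data.Nat.Coprimality using (Coprime; coprime-divisor)
open import Data.Nat.ListAction using (sum)
open import Data.Nat.ListAction.Properties using (sum-↭; sum-++)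
open import Data.Nat.Tactic.RingSolver using (solve-∀)
open import Data.Parity.Base using (0ℙ; 1ℙ) renaming (_+_ to _ℙ+_; _*_ to _ℙ*_; _⁻¹ to _ℙ⁻¹)
open import Data.Parity.Properties using (+-homo-+; *-homo-*) renaming (*-zeroʳ to ℙ*-zeroʳ)
open import Data.List using (List; []; _∷_; _++_; map; upTo)
open import Data.List.Membership.Propositional using (_∈_)
open import Data.List.Membership.Propositional.Properties
open import Data.List.Membership.Propositional.Properties.WithK using (unique∧set⇒bag)
open import Data.List.Relation.Binary.BagAndSetEquality using (∼bag⇒↭)
open import Data.List.Relation.Unary.Any using (here; there)
open import Data.List.Relation.Unary.AllPairs using ([]; _∷_)
open import Data.List.Relation.Unary.All using ([]; _∷_)
open import Data.List.Relation.Unary.Unique.Propositional using (Unique)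
import Data.List.Relation.Unary.Unique.Propositional.Properties as Unique
open import Data.Product using (∃; ∃₂; _×_; _,_; proj₁; proj₂)
open import Data.Sum using (_⊎_; inj₁; inj₂)
open import Data.Empty using (⊥; ⊥-elim)
open import Function using (_∘_)
open import Function.Bundles using (_⇔_; mk⇔; Equivalence)
import Function.Properties.Equivalence as ⇔
open import Relation.Nullary using (¬_; yes; no; contradiction)
open import Relation.Binary.PropositionalEquality

open Equivalence using (to; from)

ListsDivisors : List ℕ → ℕ → Set
ListsDivisors L n = Unique L × (∀ {x} → x ∈ L ⇔ x ∣ n)

divisors-lists : ∀ n .{{_ : NonZero n}} → ListsDivisors (divisors n) n
divisors-lists n =
  Unique.filter⁺ (_∣? n) (Unique.map⁺ suc-injective (Unique.upTo⁺ n)) , mk⇔ ∈⇒∣ ∣⇒∈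
  where
  ∈⇒∣ : ∀ {x} → x ∈ divisors n → x ∣ n
  ∈⇒∣ x∈ = proj₂ (∈-filter⁻ (_∣? n) {xs = map suc (upTo n)} x∈)
  ∣⇒∈ : ∀ {x} → x ∣ n → x ∈ divisors n
  ∣⇒∈ {zero}  0∣n = contradiction (0∣⇒≡0 0∣n) (≢-nonZero⁻¹ n)
  ∣⇒∈ {suc x} x∣n = ∈-filter⁺ (_∣? n) (∈-map⁺ suc (∈-upTo⁺ (∣⇒≤ x∣n))) x∣n

σ≡sum : ∀ {n L} .{{_ : NonZero n}} → ListsDivisors L n → σ n ≡ sum L
σ≡sum {n} (unique , ∈⇔∣) = sum-↭ (∼bag⇒↭ (unique∧set⇒bag (proj₁ (divisors-lists n)) unique
  (⇔.trans (proj₂ (divisors-lists n)) (⇔.sym ∈⇔∣))))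

∤⇒coprime : ∀ {p x} → Prime p → ¬ p ∣ x → Coprime x p
∤⇒coprime pp p∤x (d∣x , d∣p) with prime⇒irreducible pp d∣p
... | inj₁ d≡1  = d≡1
... | inj₂ refl = contradiction d∣x p∤x

odd∣2^k*m⇒∣m : ∀ {x m} → ¬ 2 ∣ x → ∀ k → x ∣ 2 ^ k * m → x ∣ m
odd∣2^k*m⇒∣m {x} {m} 2∤x zero    x∣ = subst (x ∣_) (*-identityˡ m) x∣
odd∣2^k*m⇒∣m {x} {m} 2∤x (suc k) x∣ = odd∣2^k*m⇒∣m 2∤x k
  (coprime-divisor (∤⇒coprime prime[2] 2∤x) (subst (x ∣_) (*-assoc 2 (2 ^ k) m) x∣))

halve-∣ : ∀ y k m → y * 2 ∣ 2 ^ suc k * m → y ∣ 2 ^ k * m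
halve-∣ y k m = *-cancelˡ-∣ 2 ∘ subst₂ _∣_ (*-comm y 2) (*-assoc 2 (2 ^ k) m)

divisor-shape : ∀ {x m} k → x ∣ 2 ^ k * m → x ∣ m ⊎ ∃₂ λ a o → a < k × o ∣ m × x ≡ 2 ^ suc a * o
divisor-shape {x} {m} zero    x∣ = inj₁ (subst (x ∣_) (*-identityˡ m) x∣)
divisor-shape {x} {m} (suc k) x∣ with 2 ∣? x
... | no 2∤x = inj₁ (odd∣2^k*m⇒∣m 2∤x (suc k) x∣)
... | yes (divides y refl) with divisor-shape k (halve-∣ y k m x∣)
...   | inj₁ y∣m =
  inj₂ (0 , y , s≤s z≤n , y∣m , trans (*-comm y 2) (cong (_* y) (sym (*-identityʳ 2))))
...   | inj₂ (a , o , a<k , o∣m , refl) =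
  inj₂ (suc a , o , s≤s a<k , o∣m , trans (*-comm (2 ^ suc a * o) 2) (sym (*-assoc 2 (2 ^ suc a) o)))

sum-map-* : ∀ c L → sum (map (c *_) L) ≡ c * sum L
sum-map-* c []      = sym (*-zeroʳ c)
sum-map-* c (x ∷ L) = trans (cong (c * x +_) (sum-map-* c L)) (sym (*-distribˡ-+ c x (sum L)))

doubling-divisor-list : ∀ {m k M L} → ¬ 2 ∣ m → ListsDivisors M m → ListsDivisors L (2 ^ k * m) →
                        ListsDivisors (M ++ map (2 *_) L) (2 ^ suc k * m)
doubling-divisor-list {m} {k} {M} {L} 2∤m (M-unique , M⇔) (L-unique , L⇔) =
  Unique.++⁺ M-unique (Unique.map⁺ (*-cancelˡ-≡ _ _ 2) L-unique) disjoint , mk⇔ ∈⇒∣ ∣⇒∈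
  where
  disjoint : ∀ {x} → ¬ (x ∈ M × x ∈ map (2 *_) L)
  disjoint (x∈M , x∈2L) with ∈-map⁻ (2 *_) x∈2L
  ... | y , _ , refl = 2∤m (∣-trans (m∣m*n y) (to M⇔ x∈M))
  ∈⇒∣ : ∀ {x} → x ∈ M ++ map (2 *_) L → x ∣ 2 ^ suc k * m
  ∈⇒∣ x∈ with ∈-++⁻ M x∈
  ... | inj₁ x∈M = ∣n⇒∣m*n (2 ^ suc k) (to M⇔ x∈M)
  ... | inj₂ x∈2L with ∈-map⁻ (2 *_) x∈2L
  ...   | y , y∈L , refl = subst (2 * y ∣_) (sym (*-assoc 2 (2 ^ k) m)) (*-monoʳ-∣ 2 (to L⇔ y∈L))
  ∣⇒∈ : ∀ {x} → x ∣ 2 ^ suc k * m → x ∈ M ++ map (2 *_) L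
  ∣⇒∈ {x} x∣ with 2 ∣? x
  ... | yes (divides y refl) = ∈-++⁺ʳ M
    (subst (_∈ map (2 *_) L) (*-comm 2 y) (∈-map⁺ (2 *_) (from L⇔ (halve-∣ y k m x∣))))
  ... | no 2∤x = ∈-++⁺ˡ (from M⇔ (odd∣2^k*m⇒∣m 2∤x (suc k) x∣))

divisor-list[2^k*m] : ∀ {m} .{{_ : NonZero m}} → ¬ 2 ∣ m → ∀ k →
                      ∃ λ L → ListsDivisors L (2 ^ k * m) × sum L + σ m ≡ 2 ^ suc k * σ m
divisor-list[2^k*m] {m} 2∤m zero =
  divisors m , subst (ListsDivisors (divisors m)) (sym (*-identityˡ m)) (divisors-lists m) , double (σ m)
  where
  double : ∀ x → x + x ≡ 2 * 1 * x
  double = solve-∀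
divisor-list[2^k*m] {m} 2∤m (suc k) with divisor-list[2^k*m] 2∤m k
... | L , L-lists , sum≡ =
  divisors m ++ map (2 *_) L , doubling-divisor-list {k = k} 2∤m (divisors-lists m) L-lists , (begin
    sum (divisors m ++ map (2 *_) L) + σ m ≡⟨ cong (_+ σ m) (sum-++ (divisors m) _) ⟩
    σ m + sum (map (2 *_) L) + σ m        ≡⟨ cong (λ x → σ m + x + σ m) (sum-map-* 2 L) ⟩
    σ m + 2 * sum L + σ m                 ≡⟨ regroup (σ m) (sum L) ⟩
    2 * (sum L + σ m)                     ≡⟨ cong (2 *_) sum≡ ⟩
    2 * (2 ^ suc k * σ m)                 ≡⟨ *-assoc 2 (2 ^ suc k) (σ m) ⟨
    2 ^ suc (suc k) * σ m                 ∎)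
  where
  open ≡-Reasoning
  regroup : ∀ x y → x + 2 * y + x ≡ 2 * (y + x)
  regroup = solve-∀

σ[2^k*m] : ∀ {m} .{{_ : NonZero m}} → ¬ 2 ∣ m → ∀ k → σ (2 ^ k * m) + σ m ≡ 2 ^ suc k * σ m
σ[2^k*m] {m} 2∤m k with divisor-list[2^k*m] 2∤m k
... | L , L-lists , sum≡ = trans (cong (_+ σ m) (σ≡sum {{m*n≢0 (2 ^ k) m {{m^n≢0 2 k}}}} L-lists)) sum≡

σ[2^j]+1≡2^[1+j] : ∀ j → σ (2 ^ j) + 1 ≡ 2 ^ suc j
σ[2^j]+1≡2^[1+j] j =
  subst₂ (λ x y → σ x + 1 ≡ y) (*-identityʳ (2 ^ j)) (*-identityʳ (2 ^ suc j)) (σ[2^k*m] 2∤1 j)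
  where
  2∤1 : ¬ 2 ∣ 1
  2∤1 2∣1 with () ← ∣1⇒≡1 2∣1

power-of-two-not-2-near-perfect : ∀ j {d₁ d₂} → ¬ IsOmittedPair (2 ^ j) d₁ d₂
power-of-two-not-2-near-perfect j {d₁} {d₂} (_ , _ , _ , _ , _ , σ≡) = m+1+n≢m (2 * 2 ^ j) (begin
  2 * 2 ^ j + suc (d₁ + d₂) ≡⟨ regroup (2 * 2 ^ j) d₁ d₂ ⟩
  2 * 2 ^ j + d₁ + d₂ + 1   ≡⟨ cong (_+ 1) σ≡ ⟨
  σ (2 ^ j) + 1             ≡⟨ σ[2^j]+1≡2^[1+j] j ⟩
  2 * 2 ^ j                 ∎)
  where
  open ≡-Reasoning
  regroup : ∀ x a b → x + suc (a + b) ≡ x + a + b + 1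
  regroup = solve-∀

squareDivisors : ℕ → List ℕ
squareDivisors p = 1 ∷ p ∷ p * p ∷ []

∣p*p⇒∈squareDivisors : ∀ {p x} → Prime p → x ∣ p * p → x ∈ squareDivisors p
∣p*p⇒∈squareDivisors {p} {x} pp x∣p*p with p ∣? x
... | yes (divides y refl) with prime⇒irreducible pp (*-cancelʳ-∣ {y} {p} p {{prime⇒nonZero pp}} x∣p*p)
...   | inj₁ refl = there (here (*-identityˡ p))
...   | inj₂ refl = there (there (here refl))
∣p*p⇒∈squareDivisors {p} {x} pp x∣p*p | no p∤x
  with prime⇒irreducible pp (coprime-divisor (∤⇒coprime pp p∤x) x∣p*p)
...   | inj₁ refl = here refl
...   | inj₂ refl = there (here refl)

∈squareDivisors⇒∣p*p : ∀ {p x} → x ∈ squareDivisors p → x ∣ p * p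
∈squareDivisors⇒∣p*p     (here refl)                 = 1∣ _
∈squareDivisors⇒∣p*p {p} (there (here refl))         = m∣m*n p
∈squareDivisors⇒∣p*p     (there (there (here refl))) = ∣-refl

squareDivisors-lists : ∀ {p} → Prime p → ListsDivisors (squareDivisors p) (p * p)
squareDivisors-lists {p} pp =
  ((<⇒≢ 1<p ∷ <⇒≢ 1<p*p ∷ []) ∷ (<⇒≢ p<p*p ∷ []) ∷ [] ∷ []) ,
  mk⇔ ∈squareDivisors⇒∣p*p (∣p*p⇒∈squareDivisors pp)
  where
  1<p : 1 < p
  1<p = nonTrivial⇒n>1 p {{prime⇒nonTrivial pp}}
  p<p*p : p < p * p
  p<p*p = m<m*n p p {{prime⇒nonZero pp}} 1<p
  1<p*p : 1 < p * p
  1<p*p = <-trans 1<p p<p*p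

σ[p*p] : ∀ {p} → Prime p → σ (p * p) ≡ 1 + p + p * p
σ[p*p] {p} pp = trans (σ≡sum {{m*n≢0 p p {{p≢0}} {{p≢0}}}} (squareDivisors-lists pp)) (regroup p)
  where
  p≢0 : NonZero p
  p≢0 = prime⇒nonZero pp
  regroup : ∀ p → 1 + (p + (p * p + 0)) ≡ 1 + p + p * p
  regroup = solve-∀

even-or-odd : ∀ n → ∃ λ h → n ≡ 2 * h ⊎ n ≡ 1 + 2 * h
even-or-odd zero = 0 , inj₁ refl
even-or-odd (suc n) with even-or-odd n
... | h , inj₁ refl = h , inj₂ refl
... | h , inj₂ refl = suc h , inj₁ (sym (+-suc (suc h) (h + 0)))

prime-2-or-odd : ∀ {p} → Prime p → p ≡ 2 ⊎ ∃ λ h → p ≡ 3 + 2 * h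
prime-2-or-odd {p} pp with even-or-odd p
... | h , inj₁ refl with prime⇒irreducible pp (divides h (*-comm 2 h))
...   | inj₁ ()
...   | inj₂ 2≡p = inj₁ (sym 2≡p)
prime-2-or-odd pp | zero , inj₂ refl = ⊥-elim (¬prime[1] pp)
prime-2-or-odd pp | suc h , inj₂ refl = inj₂ (h , shift h)
  where
  shift : ∀ h → 1 + 2 * (1 + h) ≡ 3 + 2 * h
  shift = solve-∀

odd*odd : ∀ x y → parity x ≡ 1ℙ → parity y ≡ 1ℙ → parity (x * y) ≡ 1ℙ
odd*odd x y odd-x odd-y = trans (*-homo-* x y) (cong₂ _ℙ*_ odd-x odd-y)

[3+2h]-odd : ∀ h → parity (3 + 2 * h) ≡ 1ℙ
[3+2h]-odd h = trans (+-homo-+ 1 (2 * h)) (cong _ℙ⁻¹ (*-homo-* 2 h))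

[3+2h]²-odd : ∀ h → parity ((3 + 2 * h) * (3 + 2 * h)) ≡ 1ℙ
[3+2h]²-odd h = odd*odd (3 + 2 * h) (3 + 2 * h) ([3+2h]-odd h) ([3+2h]-odd h)

parity[2^[1+a]*x] : ∀ a x → parity (2 ^ suc a * x) ≡ 0ℙ
parity[2^[1+a]*x] a x = trans (*-homo-* (2 ^ suc a) x) (cong (_ℙ* parity x) (*-homo-* 2 (2 ^ a)))

odd-divisor : ∀ {x m} → x ∣ m → parity m ≡ 1ℙ → parity x ≡ 1ℙ
odd-divisor {x} (divides q refl) odd with parity x in px
... | 1ℙ = refl
... | 0ℙ with () ← trans (sym odd)
  (trans (*-homo-* q x) (trans (cong (parity q ℙ*_) px) (ℙ*-zeroʳ (parity q))))

odd⇒2∤ : ∀ {x} → parity x ≡ 1ℙ → ¬ 2 ∣ x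
odd⇒2∤ odd 2∣x with () ← odd-divisor 2∣x odd

one-odd-one-even : ∀ p k d₁ d₂ → parity p ≡ 1ℙ →
                   d₁ + d₂ + (1 + p + p * p) ≡ 2 ^ suc k * (1 + p) → parity d₁ ℙ+ parity d₂ ≡ 1ℙ
one-odd-one-even p k d₁ d₂ odd eq = flip (parity d₁ ℙ+ parity d₂) (begin
  parity d₁ ℙ+ parity d₂ ℙ+ 1ℙ                ≡⟨ cong₂ _ℙ+_ (+-homo-+ d₁ d₂) σ[p²]-odd ⟨
  parity (d₁ + d₂) ℙ+ parity (1 + p + p * p) ≡⟨ +-homo-+ (d₁ + d₂) _ ⟨
  parity (d₁ + d₂ + (1 + p + p * p))         ≡⟨ cong parity eq ⟩
  parity (2 ^ suc k * (1 + p))               ≡⟨ parity[2^[1+a]*x] k (1 + p) ⟩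
  0ℙ                                         ∎)
  where
  open ≡-Reasoning
  σ[p²]-odd : parity (1 + p + p * p) ≡ 1ℙ
  σ[p²]-odd = trans (+-homo-+ (1 + p) (p * p))
    (cong₂ _ℙ+_ (trans (+-homo-+ 1 p) (cong _ℙ⁻¹ odd)) (odd*odd p p odd odd))
  flip : ∀ x → x ℙ+ 1ℙ ≡ 0ℙ → x ≡ 1ℙ
  flip 1ℙ _ = refl
  flip 0ℙ ()

omitted-sum : ∀ {p} k d₁ d₂ → Prime p → ¬ 2 ∣ p * p → IsOmittedPair (2 ^ k * (p * p)) d₁ d₂ →
              d₁ + d₂ + (1 + p + p * p) ≡ 2 ^ suc k * (1 + p)
omitted-sum {p} k d₁ d₂ pp 2∤p*p (_ , _ , _ , _ , _ , σ≡) =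
  +-cancelˡ-≡ (2 * 2 ^ k * (p * p)) _ _ (begin
    2 * 2 ^ k * (p * p) + (d₁ + d₂ + (1 + p + p * p)) ≡⟨ regroup (2 ^ k) (p * p) d₁ d₂ _ ⟩
    2 * (2 ^ k * (p * p)) + d₁ + d₂ + (1 + p + p * p) ≡⟨ cong₂ _+_ σ≡ (σ[p*p] pp) ⟨
    σ (2 ^ k * (p * p)) + σ (p * p)                   ≡⟨ σ[2^k*m] {{p*p≢0}} 2∤p*p k ⟩
    2 * 2 ^ k * σ (p * p)                             ≡⟨ cong (2 * 2 ^ k *_) (σ[p*p] pp) ⟩
    2 * 2 ^ k * (1 + p + p * p)                       ≡⟨ split (2 ^ k) p ⟩
    2 * 2 ^ k * (p * p) + 2 * 2 ^ k * (1 + p)         ∎)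
  where
  open ≡-Reasoning
  p*p≢0 : NonZero (p * p)
  p*p≢0 = m*n≢0 p p {{prime⇒nonZero pp}} {{prime⇒nonZero pp}}
  regroup : ∀ x P a b S → 2 * x * P + (a + b + S) ≡ 2 * (x * P) + a + b + S
  regroup = solve-∀
  split : ∀ x p → 2 * x * (1 + p + p * p) ≡ 2 * x * (p * p) + 2 * x * (1 + p)
  split = solve-∀

OneOf18-36-200 : ℕ → Set
OneOf18-36-200 n = n ≡ 18 ⊎ n ≡ 36 ⊎ n ≡ 200

cancel-common-part : ∀ {a b} x y → a ≡ b → a + x ≡ b + y → x ≡ y
cancel-common-part {a} x y refl = +-cancelˡ-≡ a x y

split-multiple : ∀ K X Y u .{{_ : NonZero u}} → K * u ≡ X * u + Y → ∃ λ m → K ≡ X + m × Y ≡ m * u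
split-multiple K X Y u eq with ∣m+n∣m⇒∣n (divides K (sym eq)) (n∣m*n X)
... | divides m Y≡m*u = m , *-cancelʳ-≡ K (X + m) u (begin
  K * u         ≡⟨ eq ⟩
  X * u + Y     ≡⟨ cong (X * u +_) Y≡m*u ⟩
  X * u + m * u ≡⟨ *-distribʳ-+ u X m ⟨
  (X + m) * u   ∎) , Y≡m*u
  where open ≡-Reasoning

-- With u = 1 + p, the equation s q + o + σ(p²) = 2 s r u says s D = o + σ(p²) for D = 2 r u − q,
-- so D = 2 t u − 1 (the minus equation) if q ∈ {1, p²} and D = (1 + 2 t) u + 1 (the plus
-- equation) if q = p. Writing o + σ(p²) = n₁ u + n₀ with n₀ ∈ {0, 2} gives s ≡ ∓n₀ modulo u;
-- substituting s = m u ∓ n₀ leaves an equation in m, t and p alone.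
minus-equation-reduced : ∀ t s u n₁ n₀ .{{_ : NonZero u}} → 2 * t * s * u ≡ s + (n₁ * u + n₀) →
                         ∃ λ m → n₀ + s ≡ m * u × 2 * t * (m * u) ≡ n₁ + m + 2 * t * n₀
minus-equation-reduced t s u n₁ n₀ eq =
  let (m , 2ts≡ , n₀+s≡) = split-multiple (2 * t * s) n₁ (n₀ + s) u eq′
  in m , n₀+s≡ , (begin
    2 * t * (m * u)        ≡⟨ cong (2 * t *_) n₀+s≡ ⟨
    2 * t * (n₀ + s)       ≡⟨ expand t n₀ s ⟩
    2 * t * s + 2 * t * n₀ ≡⟨ cong (_+ 2 * t * n₀) 2ts≡ ⟩
    n₁ + m + 2 * t * n₀    ∎)
  where
  open ≡-Reasoning
  eq′ : 2 * t * s * u ≡ n₁ * u + (n₀ + s)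
  eq′ = trans eq (trans (+-comm s _) (+-assoc (n₁ * u) n₀ s))
  expand : ∀ t a b → 2 * t * (a + b) ≡ 2 * t * b + 2 * t * a
  expand = solve-∀

plus-equation-reduced : ∀ c s u n₁ n₀ .{{_ : NonZero u}} →
                        (n₀ + s) + c * (n₀ + s) * u ≡ n₁ * u + n₀ →
                        ∃ λ m → s ≡ m * u × n₁ ≡ c * (n₀ + m * u) + m
plus-equation-reduced c s u n₁ n₀ eq =
  let (m , n₁≡ , s≡m*u) = split-multiple n₁ (c * (n₀ + s)) s u eq′
  in m , s≡m*u , trans n₁≡ (cong (λ x → c * (n₀ + x) + m) s≡m*u)
  where
  regroup : ∀ a b c → a + b + c ≡ a + (c + b)
  regroup = solve-∀
  eq′ : n₁ * u ≡ c * (n₀ + s) * u + s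
  eq′ = +-cancelˡ-≡ n₀ _ _ (trans (+-comm n₀ (n₁ * u)) (trans (sym eq) (regroup n₀ s _)))

1+σ[p²]≡p*[1+p]+2 : ∀ p → 1 + (1 + p + p * p) ≡ p * (1 + p) + 2
1+σ[p²]≡p*[1+p]+2 = solve-∀

p+σ[p²]≡[1+p]*[1+p] : ∀ p → p + (1 + p + p * p) ≡ (1 + p) * (1 + p) + 0
p+σ[p²]≡[1+p]*[1+p] = solve-∀

p²+σ[p²]≡[5+4h]*[1+p]+2 : ∀ h → let p = 3 + 2 * h in p * p + (1 + p + p * p) ≡ (5 + 4 * h) * (1 + p) + 2
p²+σ[p²]≡[5+4h]*[1+p]+2 = solve-∀

-- In each case below a ring identity splits the two sides into a common part and an excess;
-- the excess is a successor, or vanishes only at the solution.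
minus-equation-1 : ∀ h t s m → 2 + s ≡ m * (4 + 2 * h) →
                   2 * t * (m * (4 + 2 * h)) ≡ 3 + 2 * h + m + 2 * t * 2 → h ≡ 0 × s ≡ 2 × t ≡ 1
minus-equation-1 h zero    s m       _    ()
minus-equation-1 h (suc t) s zero    ()   _
minus-equation-1 h (suc t) s (suc m) 2+s≡ eq =
  vanishing h t m s 2+s≡ (cancel-common-part 0 _ eq (excess h t m))
  where
  excess : ∀ h t m → 2 * (1 + t) * ((1 + m) * (4 + 2 * h)) + 0
                   ≡ 3 + 2 * h + (1 + m) + 2 * (1 + t) * 2
                     + (2 * h + t * (4 + 4 * h) + m * (7 + 4 * h) + t * m * (8 + 4 * h))
  excess = solve-∀
  vanishing : ∀ h t m s → 2 + s ≡ suc m * (4 + 2 * h) →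
              0 ≡ 2 * h + t * (4 + 4 * h) + m * (7 + 4 * h) + t * m * (8 + 4 * h) →
              h ≡ 0 × s ≡ 2 × suc t ≡ 1
  vanishing zero    zero    zero    s refl _  = refl , refl , refl
  vanishing (suc h) t       m       s _    ()
  vanishing zero    (suc t) m       s _    ()
  vanishing zero    zero    (suc m) s _    ()

minus-equation-p : ∀ h t s m → 2 ≤ s → s ≡ m * (4 + 2 * h) →
                   2 * t * (m * (4 + 2 * h)) ≡ 4 + 2 * h + m + 2 * t * 0 → ⊥
minus-equation-p h zero    s m       _  _    ()
minus-equation-p h (suc t) s zero    () refl _
minus-equation-p h (suc t) s (suc m) _  _    eq = 0≢1+n (cancel-common-part 0 _ eq (excess h t m))
  where
  excess : ∀ h t m → 2 * (1 + t) * ((1 + m) * (4 + 2 * h)) + 0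
                   ≡ 4 + 2 * h + (1 + m) + 2 * (1 + t) * 0
                     + (3 + 2 * h + t * (8 + 4 * h) + m * (7 + 4 * h) + t * m * (8 + 4 * h))
  excess = solve-∀

minus-equation-p² : ∀ h t s m → 2 + s ≡ m * (4 + 2 * h) →
                    2 * t * (m * (4 + 2 * h)) ≡ 5 + 4 * h + m + 2 * t * 2 → ⊥
minus-equation-p² h zero    s m       _  ()
minus-equation-p² h (suc t) s zero    () _
minus-equation-p² h (suc t) s (suc m) _  eq = excess≢2 h t m (cancel-common-part 2 _ eq (excess h t m))
  where
  excess : ∀ h t m → 2 * (1 + t) * ((1 + m) * (4 + 2 * h)) + 2
                   ≡ 5 + 4 * h + (1 + m) + 2 * (1 + t) * 2
                     + (t * (4 + 4 * h) + m * (7 + 4 * h) + t * m * (8 + 4 * h))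
  excess = solve-∀
  excess≢2 : ∀ h t m → 2 ≢ t * (4 + 4 * h) + m * (7 + 4 * h) + t * m * (8 + 4 * h)
  excess≢2 h zero    zero    ()
  excess≢2 h (suc t) m       ()
  excess≢2 h zero    (suc m) ()

odd≢even : ∀ {x} a b → x ≡ 1 + 2 * a → x ≢ 2 * b
odd≢even a b odd even = even≢odd b a (trans (sym even) odd)

[1+2t]*2+0≡2*[1+2t] : ∀ t → (1 + 2 * t) * 2 + 0 ≡ 2 * (1 + 2 * t)
[1+2t]*2+0≡2*[1+2t] = solve-∀

plus-equation-1 : ∀ h t m → 3 + 2 * h ≡ (1 + 2 * t) * (2 + m * (4 + 2 * h)) + m → ⊥
plus-equation-1 h t zero    eq =
  odd≢even (1 + h) (1 + 2 * t) (odd h) (trans eq ([1+2t]*2+0≡2*[1+2t] t))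
  where
  odd : ∀ h → 3 + 2 * h ≡ 1 + 2 * (1 + h)
  odd = solve-∀
plus-equation-1 h t (suc m) eq = 1+n≢0 (cancel-common-part _ 0 eq (excess h t m))
  where
  excess : ∀ h t m → 3 + 2 * h + (4 + m + m * (4 + 2 * h) + 2 * t * (2 + (1 + m) * (4 + 2 * h)))
                   ≡ (1 + 2 * t) * (2 + (1 + m) * (4 + 2 * h)) + (1 + m) + 0
  excess = solve-∀

plus-equation-p : ∀ h t s m → 2 ≤ s → s ≡ m * (4 + 2 * h) →
                  4 + 2 * h ≡ (1 + 2 * t) * (0 + m * (4 + 2 * h)) + m → ⊥
plus-equation-p h t s zero    () refl _
plus-equation-p h t s (suc m) _  _    eq = 1+n≢0 (cancel-common-part _ 0 eq (excess h t m))
  where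
  excess : ∀ h t m → 4 + 2 * h + (1 + m + m * (4 + 2 * h) + 2 * t * ((1 + m) * (4 + 2 * h)))
                   ≡ (1 + 2 * t) * (0 + (1 + m) * (4 + 2 * h)) + (1 + m) + 0
  excess = solve-∀

plus-equation-p² : ∀ h t s m → s ≡ m * (4 + 2 * h) →
                   5 + 4 * h ≡ (1 + 2 * t) * (2 + m * (4 + 2 * h)) + m → h ≡ 1 × 2 + s ≡ 8 × t ≡ 0
plus-equation-p² h t s zero _ eq =
  ⊥-elim (odd≢even (2 + 2 * h) (1 + 2 * t) (odd h) (trans eq ([1+2t]*2+0≡2*[1+2t] t)))
  where
  odd : ∀ h → 5 + 4 * h ≡ 1 + 2 * (2 + 2 * h)
  odd = solve-∀
plus-equation-p² h (suc t) s (suc m) _ eq = ⊥-elim (1+n≢0 (cancel-common-part _ 0 eq (excess h t m)))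
  where
  excess : ∀ h t m → 5 + 4 * h
                     + (14 + 2 * h + m + 3 * m * (4 + 2 * h) + 2 * t * (2 + (1 + m) * (4 + 2 * h)))
                   ≡ (1 + 2 * (1 + t)) * (2 + (1 + m) * (4 + 2 * h)) + (1 + m) + 0
  excess = solve-∀
plus-equation-p² h zero s (suc (suc m)) _ eq = ⊥-elim (1+n≢0 (cancel-common-part _ 0 eq (excess h m)))
  where
  excess : ∀ h m → 5 + 4 * h + (7 + m + m * (4 + 2 * h))
                 ≡ (1 + 2 * 0) * (2 + (2 + m) * (4 + 2 * h)) + (2 + m) + 0
  excess = solve-∀
plus-equation-p² h zero s 1 s≡ eq =
  h≡1 , cong (2 +_) (trans s≡ (cong (λ h → 1 * (4 + 2 * h)) h≡1)) , refl
  where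
  linear : ∀ h → 5 + 4 * h + 2 ≡ (1 + 2 * 0) * (2 + 1 * (4 + 2 * h)) + 1 + 2 * h
  linear = solve-∀
  h≡1 : h ≡ 1
  h≡1 = sym (*-cancelˡ-≡ 1 h 2 (cancel-common-part 2 (2 * h) eq (linear h)))

minus-equation : ∀ h t {p s o} → p ≡ 3 + 2 * h → o ∈ squareDivisors p → 2 ≤ s →
                 2 * t * s * (1 + p) ≡ s + (o + (1 + p + p * p)) → o ≡ 1 × h ≡ 0 × s ≡ 2 × t ≡ 1
minus-equation h t {p} {s} refl (here refl) _ eq =
  let (m , 2+s≡ , eq′) = minus-equation-reduced t s (1 + p) p 2
                           (trans eq (cong (s +_) (1+σ[p²]≡p*[1+p]+2 p)))
  in refl , minus-equation-1 h t s m 2+s≡ eq′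
minus-equation h t {p} {s} refl (there (here refl)) 2≤s eq =
  let (m , s≡ , eq′) = minus-equation-reduced t s (1 + p) (1 + p) 0
                         (trans eq (cong (s +_) (p+σ[p²]≡[1+p]*[1+p] p)))
  in ⊥-elim (minus-equation-p h t s m 2≤s s≡ eq′)
minus-equation h t {p} {s} refl (there (there (here refl))) _ eq =
  let (m , 2+s≡ , eq′) = minus-equation-reduced t s (1 + p) (5 + 4 * h) 2
                           (trans eq (cong (s +_) (p²+σ[p²]≡[5+4h]*[1+p]+2 h)))
  in ⊥-elim (minus-equation-p² h t s m 2+s≡ eq′)

plus-equation : ∀ h t {p s o} → p ≡ 3 + 2 * h → o ∈ squareDivisors p → 2 ≤ s →
                s + (1 + 2 * t) * s * (1 + p) ≡ o + (1 + p + p * p) → o ≡ p * p × h ≡ 1 × s ≡ 8 × t ≡ 0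
plus-equation h t {p} {s} refl (there (here refl)) 2≤s eq =
  let (m , s≡ , eq′) = plus-equation-reduced (1 + 2 * t) s (1 + p) (1 + p) 0
                         (trans eq (p+σ[p²]≡[1+p]*[1+p] p))
  in ⊥-elim (plus-equation-p h t s m 2≤s s≡ eq′)
plus-equation h t {p} {suc (suc s)} refl (here refl) (s≤s (s≤s z≤n)) eq =
  let (m , _ , eq′) = plus-equation-reduced (1 + 2 * t) s (1 + p) p 2 (trans eq (1+σ[p²]≡p*[1+p]+2 p))
  in ⊥-elim (plus-equation-1 h t m eq′)
plus-equation h t {p} {suc (suc s)} refl (there (there (here refl))) (s≤s (s≤s z≤n)) eq =
  let (m , s≡ , eq′) = plus-equation-reduced (1 + 2 * t) s (1 + p) (5 + 4 * h) 2
                         (trans eq (p²+σ[p²]≡[5+4h]*[1+p]+2 h))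
  in refl , plus-equation-p² h t s m s≡ eq′

q≡1⇒minus-equation : ∀ o s r u S → o + s * 1 + S ≡ 2 * (s * r) * u → 2 * r * s * u ≡ s + (o + S)
q≡1⇒minus-equation o s r u S eq = trans (regroup-right s r u) (trans (sym eq) (regroup-left o s S))
  where
  regroup-right : ∀ s r u → 2 * r * s * u ≡ 2 * (s * r) * u
  regroup-right = solve-∀
  regroup-left : ∀ o s S → o + s * 1 + S ≡ s + (o + S)
  regroup-left = solve-∀

q≡p⇒plus-equation : ∀ p o s r → o + s * p + (1 + p + p * p) ≡ 2 * (s * r) * (1 + p) →
                    ∃ λ t → r ≡ 1 + t × s + (1 + 2 * t) * s * (1 + p) ≡ o + (1 + p + p * p)
q≡p⇒plus-equation p o s zero eq =
  ⊥-elim (m+1+n≢0 (o + s * p) (trans eq (cong (λ x → 2 * x * (1 + p)) (*-zeroʳ s))))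
q≡p⇒plus-equation p o s (suc t) eq =
  t , refl , +-cancelˡ-≡ (s * p) _ _ (trans (sym (split-right p s t)) (trans (sym eq) (split-left o s p _)))
  where
  split-right : ∀ p s t → 2 * (s * (1 + t)) * (1 + p) ≡ s * p + (s + (1 + 2 * t) * s * (1 + p))
  split-right = solve-∀
  split-left : ∀ o s p S → o + s * p + S ≡ s * p + (o + S)
  split-left = solve-∀

q≡p²⇒minus-equation : ∀ h o s r → let p = 3 + 2 * h in 2 ≤ s →
                      o + s * (p * p) + (1 + p + p * p) ≡ 2 * (s * r) * (1 + p) →
                      ∃ λ t → r ≡ 1 + h + t × 2 * t * s * (1 + p) ≡ s + (o + (1 + p + p * p))
q≡p²⇒minus-equation h o (suc s) r _ eq =
  let (t , r≡ , rest≡) = split-multiple r (1 + h) (suc s + (o + S)) (2 * suc s * (4 + 2 * h)) eq′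
  in t , r≡ , trans (regroup t (suc s) (4 + 2 * h)) (sym rest≡)
  where
  S : ℕ
  S = 1 + (3 + 2 * h) + (3 + 2 * h) * (3 + 2 * h)
  regroup : ∀ t s u → 2 * t * s * u ≡ t * (2 * s * u)
  regroup = solve-∀
  scale : ∀ s r u → r * (2 * s * u) ≡ 2 * (s * r) * u
  scale = solve-∀
  square : ∀ h o s S → o + s * ((3 + 2 * h) * (3 + 2 * h)) + S
                     ≡ (1 + h) * (2 * s * (4 + 2 * h)) + (s + (o + S))
  square = solve-∀
  eq′ : r * (2 * suc s * (4 + 2 * h)) ≡ (1 + h) * (2 * suc s * (4 + 2 * h)) + (suc s + (o + S))
  eq′ = trans (scale (suc s) r (4 + 2 * h)) (trans (sym eq) (square h o (suc s) S))

divisor-equation-solutions : ∀ h {p s r o q} → p ≡ 3 + 2 * h →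
                             o ∈ squareDivisors p → q ∈ squareDivisors p → 2 ≤ s →
                             o + s * q + (1 + p + p * p) ≡ 2 * (s * r) * (1 + p) →
                             OneOf18-36-200 (s * r * (p * p))
divisor-equation-solutions h {p} {s} {r} {o} refl o∈ (here refl) 2≤s eq
  with minus-equation h r refl o∈ 2≤s (q≡1⇒minus-equation o s r (1 + p) _ eq)
... | refl , refl , refl , refl = inj₁ refl
divisor-equation-solutions h {p} {s} {r} {o} refl o∈ (there (here refl)) 2≤s eq
  with q≡p⇒plus-equation p o s r eq
... | t , refl , eq′ with plus-equation h t refl o∈ 2≤s eq′
...   | refl , refl , refl , refl = inj₂ (inj₂ refl)
divisor-equation-solutions h {p} {s} {r} {o} refl o∈ (there (there (here refl))) 2≤s eq
  with q≡p²⇒minus-equation h o s r 2≤s eq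
... | t , refl , eq′ with minus-equation h t refl o∈ 2≤s eq′
...   | refl , refl , refl , refl = inj₂ (inj₁ refl)

odd-even-pair-solutions : ∀ h {p k a o q} → p ≡ 3 + 2 * h →
                          o ∈ squareDivisors p → q ∈ squareDivisors p → a < k →
                          o + 2 ^ suc a * q + (1 + p + p * p) ≡ 2 ^ suc k * (1 + p) →
                          OneOf18-36-200 (2 ^ k * (p * p))
odd-even-pair-solutions h {p} {k} {a} {o} {q} p≡ o∈ q∈ a<k eq with m≤n⇒∃[o]m+o≡n a<k
... | j , refl =
  subst OneOf18-36-200 (cong (_* (p * p)) (sym 2^k≡))
    (divisor-equation-solutions h p≡ o∈ q∈ 2≤2^[1+a] eq′)
  where
  2^k≡ : 2 ^ (suc a + j) ≡ 2 ^ suc a * 2 ^ j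
  2^k≡ = ^-distribˡ-+-* 2 (suc a) j
  2≤2^[1+a] : 2 ≤ 2 ^ suc a
  2≤2^[1+a] = *-monoʳ-≤ 2 (m^n>0 2 a)
  eq′ : o + 2 ^ suc a * q + (1 + p + p * p) ≡ 2 * (2 ^ suc a * 2 ^ j) * (1 + p)
  eq′ = trans eq (cong (λ x → 2 * x * (1 + p)) 2^k≡)

odd-prime-solutions : ∀ h k {p d₁ d₂} → p ≡ 3 + 2 * h → Prime p →
                      d₁ ∣ 2 ^ k * (p * p) → d₂ ∣ 2 ^ k * (p * p) →
                      d₁ + d₂ + (1 + p + p * p) ≡ 2 ^ suc k * (1 + p) → OneOf18-36-200 (2 ^ k * (p * p))
odd-prime-solutions h k {p} {d₁} {d₂} refl pp d₁∣ d₂∣ eq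
  with divisor-shape k d₁∣ | divisor-shape k d₂∣ | one-odd-one-even p k d₁ d₂ ([3+2h]-odd h) eq
... | inj₁ d₁∣p² | inj₁ d₂∣p² | odd-sum
  with () ← trans (sym odd-sum)
    (cong₂ _ℙ+_ (odd-divisor d₁∣p² ([3+2h]²-odd h)) (odd-divisor d₂∣p² ([3+2h]²-odd h)))
... | inj₂ (a₁ , o₁ , _ , _ , refl) | inj₂ (a₂ , o₂ , _ , _ , refl) | odd-sum
  with () ← trans (sym odd-sum) (cong₂ _ℙ+_ (parity[2^[1+a]*x] a₁ o₁) (parity[2^[1+a]*x] a₂ o₂))
... | inj₁ d₁∣p² | inj₂ (a , q , a<k , q∣p² , refl) | _ =
  odd-even-pair-solutions h refl (∣p*p⇒∈squareDivisors pp d₁∣p²) (∣p*p⇒∈squareDivisors pp q∣p²)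
    a<k eq
... | inj₂ (a , q , a<k , q∣p² , refl) | inj₁ d₂∣p² | _ =
  odd-even-pair-solutions h refl (∣p*p⇒∈squareDivisors pp d₂∣p²) (∣p*p⇒∈squareDivisors pp q∣p²)
    a<k (trans (cong (_+ (1 + p + p * p)) (+-comm d₂ (2 ^ suc a * q))) eq)

theorem2 : (n d₁ d₂ k p : ℕ) → 0 < n → IsOmittedPair n d₁ d₂ → Prime p → n ≡ 2 ^ k * p ^ 2 → n ≡ 18 ⊎ n ≡ 36 ⊎ n ≡ 200
theorem2 _ d₁ d₂ k p _ omitted pp refl with prime-2-or-odd pp
... | inj₁ refl =
  ⊥-elim (power-of-two-not-2-near-perfect (k + 2) (subst (λ n → IsOmittedPair n d₁ d₂) 2^k*2^2≡ omitted))
  where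
  2^k*2^2≡ : 2 ^ k * 2 ^ 2 ≡ 2 ^ (k + 2)
  2^k*2^2≡ = sym (^-distribˡ-+-* 2 k 2)
... | inj₂ (h , refl) = subst OneOf18-36-200 (sym p^2≡)
  (odd-prime-solutions h k refl pp (proj₁ omitted′) (proj₁ (proj₂ omitted′))
    (omitted-sum k d₁ d₂ pp (odd⇒2∤ ([3+2h]²-odd h)) omitted′))
  where
  p^2≡ : 2 ^ k * p ^ 2 ≡ 2 ^ k * (p * p)
  p^2≡ = cong (λ x → 2 ^ k * (p * x)) (*-identityʳ p)
  omitted′ : IsOmittedPair (2 ^ k * (p * p)) d₁ d₂
  omitted′ = subst (λ n → IsOmittedPair n d₁ d₂) p^2≡ omitted
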